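{- For every $n\ge1$ there is a bijection \[ \mathcal{M}^+(2n)\longrightarrow\biguplus_{\pi\in\mathcal{P}(2n)}\ \prod_{V\in\pi}\mathcal{I}(V). \]
   Context: For a finite set $V$ of positive integers, a matching of $V$ is a set partition into blocks (arches) of size $2$; its crossing graph $G(\sigma)$ has the arches as vertices and an edge between $\{i,j\}$ and $\{k,\ell\}$ iff $i<k<j<\ell$. $G(\sigma)$ is rooted at the arch containing $\min V$. $\mathcal{M}^+(2n)$ is the set of pairs $(\sigma,r)$ with $\sigma$ a matching of $\{1,\dots,2n\}$ and $r$ any orientation of the edges of $G(\sigma)$ (augmented matchings). $\mathcal{I}(V)$ is the set of pairs $(\sigma,r)$ with $\sigma$ a connected matching of $V$ (no proper subinterval of $V$ in its induced order is a union of arches; equivalently $G(\sigma)$ is connected) and $r$ a root-connected orientation of $G(\sigma)$, i.e. every vertex is reachable by a directed path from the root; $\mathcal{I}(V)=\emptyset$ if $\#V$ is odd. $\mathcal{P}(2n)$ is the set of set partitions of $\{1,\dots,2n\}$. -}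

module Defs where

open import Data.Nat using (ℕ)
open import Data.Fin using (Fin; _<_; _≤_)
open import Data.Fin.Subset using (Subset; _∈_; _∉_; ⊤; Nonempty; Empty; _∩_)
open import Data.Vec using (Vec; lookup)
open import Data.Bool using (Bool; true; false)
open import Data.List using (List)
open import Data.List.Relation.Unary.All using (All)
open import Data.List.Relation.Unary.Any using (Any)
open import Data.List.Relation.Unary.AllPairs using (AllPairs)
open import Data.Product using (Σ; _×_)
open import Data.Sum using (_⊎_)
open import Relation.Nullary using (¬_)
open import Relation.Binary.PropositionalEquality using (_≡_; _≢_)
open import Relation.Binary.Construct.Closure.ReflexiveTransitive using (Star)

-- Ground set {1,…,m} is modelled by Fin m = {0,…,m-1} with its natural order.

-- A matching of V ⊆ Fin m, encoded as a fixed-point-free involution of V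
-- (the arches are the pairs {i , σ i}); off V the vector is the identity
-- (canonical padding, so that equal matchings have equal data).
record MatchingOn {m : ℕ} (V : Subset m) : Set where
  constructor mkMatching
  field
    σ        : Vec (Fin m) m
    .inV     : ∀ i → i ∈ V → lookup σ i ∈ V
    .noFix   : ∀ i → i ∈ V → lookup σ i ≢ i
    .invol   : ∀ i → i ∈ V → lookup σ (lookup σ i) ≡ i
    .outside : ∀ i → i ∉ V → lookup σ i ≡ i

-- An arch is identified with its opener (its smaller element).
Opener : {m : ℕ} → Vec (Fin m) m → Fin m → Set
Opener σ i = i < lookup σ i

Cross : {m : ℕ} → Vec (Fin m) m → Fin m → Fin m → Set
Cross σ i k = (i < k) × (k < lookup σ i) × (lookup σ i < lookup σ k)

Edge : {m : ℕ} → Vec (Fin m) m → Fin m → Fin m → Set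
Edge σ a b = Opener σ a × Opener σ b × (Cross σ a b ⊎ Cross σ b a)

-- An orientation of G(σ): a set of directed arcs (arc a b = true means a → b)
-- containing exactly one of the two directions of every edge and nothing else.
record Orientation {m : ℕ} (σ : Vec (Fin m) m) : Set where
  constructor mkOrientation
  field
    arc      : Vec (Vec Bool m) m
    .onEdges : ∀ a b → lookup (lookup arc a) b ≡ true → Edge σ a b
    .oneDir  : ∀ a b → Edge σ a b →
                 (lookup (lookup arc a) b ≡ true × lookup (lookup arc b) a ≡ false)
               ⊎ (lookup (lookup arc a) b ≡ false × lookup (lookup arc b) a ≡ true)

Arc : {m : ℕ} {σ : Vec (Fin m) m} → Orientation σ → Fin m → Fin m → Set
Arc o a b = lookup (lookup (Orientation.arc o) a) b ≡ true

record AugMatching (m : ℕ) : Set where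
  constructor mkAug
  field
    matching : MatchingOn {m} ⊤
    orient   : Orientation (MatchingOn.σ matching)

-- I(V): connected matchings of V with a root-connected orientation.
-- The root is the arch containing min V (whose opener is min V).
IsMin : {m : ℕ} → Subset m → Fin m → Set
IsMin V r = r ∈ V × (∀ j → j ∈ V → r ≤ j)

record Irred {m : ℕ} (V : Subset m) : Set where
  constructor mkIrred
  field
    matching   : MatchingOn V
    orient     : Orientation (MatchingOn.σ matching)
    .connected : ∀ a b → Opener (MatchingOn.σ matching) a → Opener (MatchingOn.σ matching) b →
                   Star (Edge (MatchingOn.σ matching)) a b
    .rootConn  : ∀ r → IsMin V r → ∀ a → Opener (MatchingOn.σ matching) a →
                   Star (Arc orient) r a

-- min A < min B  (used to list blocks canonically by increasing minimum)
MinBefore : {m : ℕ} → Subset m → Subset m → Set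
MinBefore {m} A B = Σ (Fin m) (λ j → j ∈ A × (∀ i → i ∈ B → j < i))

record SetPartition (m : ℕ) : Set where
  constructor mkPartition
  field
    blocks    : List (Subset m)
    .nonempty : All Nonempty blocks
    .disjoint : AllPairs (λ A B → Empty (A ∩ B)) blocks
    .covers   : ∀ i → Any (i ∈_) blocks
    .sorted   : AllPairs MinBefore blocks

PartIrred : ℕ → Set
PartIrred m = Σ (SetPartition m) (λ π → All Irred (SetPartition.blocks π))

module Submission where

-- Let r be the least element of W and C the set of arches reachable from the arch of r in an
-- augmented matching on W. The arches meeting C cover a set R ∋ r on which the restricted
-- orientation is root-connected, so it lies in I(R), and every crossing edge between R and
-- W ∖ R is oriented into R, since otherwise its other end would be reachable. Conversely an
-- element of I(R) and an augmented matching on W ∖ R glue back by orienting all crossing edges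
-- into R; the two maps are inverse. Iterating on W ∖ R peels off the blocks of a set partition
-- in increasing order of their minima.

open import Defs
open import Data.Nat using (ℕ; _*_; _≤_)
open import Function.Bundles using (_⤖_)

open import Level using (0ℓ)
open import Data.Bool using (Bool; true; false; if_then_else_)
import Data.Bool.Properties as Bool
open import Data.Empty using (⊥-elim)
import Data.Empty.Irrelevant as Irrelevant
open import Data.Fin as Fin using (Fin; _<_; _<?_)
import Data.Fin.Properties as Fin
open import Data.Fin.Subset using (Subset; ⊤; _∈_; _∉_; _⊆_; _─_; ⁅_⁆; ∣_∣; Nonempty; Empty; _∩_)
open import Data.Fin.Subset.Properties
  using ( _∈?_; ∈⊤; ⊆-antisym; ⊆-trans; ∣p∣≤n; x∈⁅x⁆; x∈⁅y⁆⇒x≡y; x∈p∩q⁺; x∈p∩q⁻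
        ; x∈p∧x∉q⇒x∈p─q; p─q⊆p; p⊂q⇒∣p∣<∣q∣; p∩q≢∅⇒∣p─q∣<∣p∣)
open import Data.List using (List; []; _∷_)
open import Data.List.Relation.Unary.All as All using (All; []; _∷_)
open import Data.List.Relation.Unary.AllPairs as AllPairs using (AllPairs; []; _∷_)
open import Data.List.Relation.Unary.Any using (Any; here; there)
import Data.Nat as ℕ
import Data.Nat.Properties as ℕ
open import Data.Product using (Σ; ∃; _×_; _,_; proj₁; proj₂)
open import Data.Product.Function.Dependent.Propositional using (Σ-↔)
open import Data.Product.Function.NonDependent.Propositional using (_×-↔_)
open import Data.Sum using (_⊎_; inj₁; inj₂; swap)
open import Data.Vec as Vec using (Vec; lookup; tabulate; _∷_)
open import Data.Vec.Properties using (lookup∘tabulate; tabulate∘lookup; tabulate-cong; []=⇒lookup; lookup⇒[]=)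
open import Function.Base using (id; _∘′_)
open import Function.Bundles using (_↔_; mk↔ₛ′)
open import Function.Properties.Inverse using (↔-refl; ↔-sym; ↔-trans; ↔⇒⤖)
open import Relation.Binary.Construct.Closure.ReflexiveTransitive as Star using (Star; ε; _◅_; _◅◅_)
open import Relation.Binary.Definitions using (tri<; tri≈; tri>)
open import Relation.Binary.PropositionalEquality
open import Relation.Nullary using (¬_; Dec; yes; no; does; contradiction)
open import Relation.Nullary.Decidable using (recompute; dec-true; dec-false; ¬?; _×-dec_; _⊎-dec_)
open import Relation.Unary using (Pred; Decidable)

private variable
  m : ℕ

vec-ext : {A : Set} {u v : Vec A m} → (∀ i → lookup u i ≡ lookup v i) → u ≡ v
vec-ext {u = u} {v} eq = trans (sym (tabulate∘lookup u)) (trans (tabulate-cong eq) (tabulate∘lookup v))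

lookup²∘tabulate² : {A : Set} (f : Fin m → Fin m → A) (a b : Fin m) →
                    lookup (lookup (tabulate (λ x → tabulate (f x))) a) b ≡ f a b
lookup²∘tabulate² f a b = trans (cong (λ row → lookup row b) (lookup∘tabulate _ a)) (lookup∘tabulate (f a) b)

does⇒ : {A : Set} (A? : Dec A) → does A? ≡ true → A
does⇒ (yes a) _ = a

does≡ : {A : Set} {x : Bool} (A? : Dec A) → (A → x ≡ true) → (¬ A → x ≡ false) → does A? ≡ x
does≡ (yes a) if-yes _     = sym (if-yes a)
does≡ (no ¬a) _      if-no = sym (if-no ¬a)

subset : {P : Pred (Fin m) 0ℓ} → Decidable P → Subset m
subset P? = tabulate (λ i → does (P? i))

module _ {P : Pred (Fin m) 0ℓ} (P? : Decidable P) {i : Fin m} where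

  ∈subset⁺ : P i → i ∈ subset P?
  ∈subset⁺ p = lookup⇒[]= i _ (trans (lookup∘tabulate _ i) (dec-true (P? i) p))

  ∈subset⁻ : i ∈ subset P? → P i
  ∈subset⁻ h = does⇒ (P? i) (trans (sym (lookup∘tabulate (λ j → does (P? j)) i)) ([]=⇒lookup h))

x∈p─q⇒x∉q : ∀ {x : Fin m} (p q : Subset m) → x ∈ p ─ q → x ∉ q
x∈p─q⇒x∉q (true ∷ p) (false ∷ q) Vec.here ()
x∈p─q⇒x∉q (_ ∷ p)    (_ ∷ q)     (Vec.there x∈p─q) (Vec.there x∈q) = x∈p─q⇒x∉q p q x∈p─q x∈q

module _ {W : Subset m} where

  σ-closed : (M : MatchingOn W) → ∀ {i} → i ∈ W → lookup (MatchingOn.σ M) i ∈ W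
  σ-closed (mkMatching σ inV _ _ _) {i} i∈W = recompute (lookup σ i ∈? W) (inV i i∈W)

  σ-noFix : (M : MatchingOn W) → ∀ {i} → i ∈ W → lookup (MatchingOn.σ M) i ≢ i
  σ-noFix (mkMatching _ _ noFix _ _) {i} i∈W eq = Irrelevant.⊥-elim (noFix i i∈W eq)

  σ-involutive : (M : MatchingOn W) → ∀ {i} → i ∈ W → lookup (MatchingOn.σ M) (lookup (MatchingOn.σ M) i) ≡ i
  σ-involutive (mkMatching _ _ _ invol _) {i} i∈W = recompute (_ Fin.≟ i) (invol i i∈W)

  σ-outside : (M : MatchingOn W) → ∀ {i} → i ∉ W → lookup (MatchingOn.σ M) i ≡ i
  σ-outside (mkMatching _ _ _ _ outside) {i} i∉W = recompute (_ Fin.≟ i) (outside i i∉W)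

module _ {W : Subset m} (M : MatchingOn W) where
  open MatchingOn M using (σ)

  opener-∈ : ∀ {a} → Opener σ a → a ∈ W
  opener-∈ {a} a<σa with a ∈? W
  ... | yes a∈W = a∈W
  ... | no  a∉W = contradiction (subst (a <_) (σ-outside M a∉W) a<σa) (Fin.<-irrefl refl)

  Edge-∈ˡ : ∀ {a b} → Edge σ a b → a ∈ W
  Edge-∈ˡ (oa , _ , _) = opener-∈ oa

  Edge-∈ʳ : ∀ {a b} → Edge σ a b → b ∈ W
  Edge-∈ʳ (_ , ob , _) = opener-∈ ob

  partner-¬opener : ∀ {a} → Opener σ a → ¬ Opener σ (lookup σ a)
  partner-¬opener {a} a<σa σa<a =
    ℕ.<-asym a<σa (subst (lookup σ a <_) (σ-involutive M (opener-∈ a<σa)) σa<a)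

module _ {σ τ : Vec (Fin m) m} {a b : Fin m} where

  Edge-cong : lookup σ a ≡ lookup τ a → lookup σ b ≡ lookup τ b → Edge σ a b → Edge τ a b
  Edge-cong eqa eqb (oa , ob , inj₁ (a<b , b<σa , σa<σb)) =
    subst (a <_) eqa oa , subst (b <_) eqb ob , inj₁ (a<b , subst (b <_) eqa b<σa , subst₂ _<_ eqa eqb σa<σb)
  Edge-cong eqa eqb (oa , ob , inj₂ (b<a , a<σb , σb<σa)) =
    subst (a <_) eqa oa , subst (b <_) eqb ob , inj₂ (b<a , subst (a <_) eqb a<σb , subst₂ _<_ eqb eqa σb<σa)

Edge-sym : ∀ {σ : Vec (Fin m) m} {a b} → Edge σ a b → Edge σ b a
Edge-sym (oa , ob , cross) = ob , oa , swap cross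

Edge? : (σ : Vec (Fin m) m) (a b : Fin m) → Dec (Edge σ a b)
Edge? σ a b = (a <? lookup σ a) ×-dec (b <? lookup σ b) ×-dec (Cross? a b ⊎-dec Cross? b a)
  where
  Cross? : ∀ x y → Dec (Cross σ x y)
  Cross? x y = (x <? y) ×-dec (y <? lookup σ x) ×-dec (lookup σ x <? lookup σ y)

arcOf : {σ : Vec (Fin m) m} → Orientation σ → Fin m → Fin m → Bool
arcOf o a b = lookup (lookup (Orientation.arc o) a) b

OneWay : Bool → Bool → Set
OneWay x y = (x ≡ true × y ≡ false) ⊎ (x ≡ false × y ≡ true)

OneWay? : ∀ x y → Dec (OneWay x y)
OneWay? x y = ((x Bool.≟ true) ×-dec (y Bool.≟ false)) ⊎-dec ((x Bool.≟ false) ×-dec (y Bool.≟ true))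

module _ {σ : Vec (Fin m) m} where

  Arc⇒Edge : (o : Orientation σ) → ∀ {a b} → Arc o a b → Edge σ a b
  Arc⇒Edge (mkOrientation _ onEdges _) {a} {b} e = recompute (Edge? σ a b) (onEdges a b e)

  Edge⇒OneWay : (o : Orientation σ) → ∀ {a b} → Edge σ a b → OneWay (arcOf o a b) (arcOf o b a)
  Edge⇒OneWay (mkOrientation _ _ oneDir) {a} {b} e = recompute (OneWay? _ _) (oneDir a b e)

  ¬Edge⇒¬Arc : (o : Orientation σ) → ∀ {a b} → ¬ Edge σ a b → arcOf o a b ≡ false
  ¬Edge⇒¬Arc o ¬e = Bool.¬-not (¬e ∘′ Arc⇒Edge o)

  Star⇒≡⊎Opener : (o : Orientation σ) → ∀ {a b} → Star (Arc o) a b → a ≡ b ⊎ Opener σ b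
  Star⇒≡⊎Opener o ε = inj₁ refl
  Star⇒≡⊎Opener o (e ◅ path) with Star⇒≡⊎Opener o path
  ... | inj₁ refl = inj₂ (proj₁ (proj₂ (Arc⇒Edge o e)))
  ... | inj₂ ob   = inj₂ ob

  orientation : (f : Fin m → Fin m → Bool) →
                (∀ {a b} → f a b ≡ true → Edge σ a b) →
                (∀ {a b} → Edge σ a b → OneWay (f a b) (f b a)) → Orientation σ
  orientation f onEdges oneWay = mkOrientation (tabulate (λ a → tabulate (f a)))
    (λ a b e → onEdges (trans (sym (lookup²∘tabulate² f a b)) e))
    (λ a b e → subst₂ OneWay (sym (lookup²∘tabulate² f a b)) (sym (lookup²∘tabulate² f b a)) (oneWay e))

Aug : Subset m → Set
Aug W = Σ (MatchingOn W) (λ M → Orientation (MatchingOn.σ M))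

-- Equal underlying data; the carriers V and V′ may differ.
_≈ᴬ_ : {V V′ : Subset m} → Aug V → Aug V′ → Set
A ≈ᴬ B = (∀ i → lookup (MatchingOn.σ (proj₁ A)) i ≡ lookup (MatchingOn.σ (proj₁ B)) i)
       × (∀ a b → arcOf (proj₂ A) a b ≡ arcOf (proj₂ B) a b)

≈ᴬ⇒≡ : {V : Subset m} (A B : Aug V) → A ≈ᴬ B → A ≡ B
≈ᴬ⇒≡ (mkMatching σ _ _ _ _ , mkOrientation arc _ _) (mkMatching σ′ _ _ _ _ , mkOrientation arc′ _ _)
      (σ≗σ′ , arc≗arc′)
  with vec-ext {u = σ} {σ′} σ≗σ′ | vec-ext {u = arc} {arc′} (λ a → vec-ext (arc≗arc′ a))
... | refl | refl = refl

piecewise : Subset m → (Fin m → Fin m) → (Fin m → Fin m) → Vec (Fin m) m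
piecewise R f g = tabulate (λ i → if does (i ∈? R) then f i else g i)

module _ {R : Subset m} (f g : Fin m → Fin m) {i : Fin m} where

  piecewise-∈ : i ∈ R → lookup (piecewise R f g) i ≡ f i
  piecewise-∈ i∈R rewrite lookup∘tabulate (λ j → if does (j ∈? R) then f j else g j) i
                        | dec-true (i ∈? R) i∈R = refl

  piecewise-∉ : i ∉ R → lookup (piecewise R f g) i ≡ g i
  piecewise-∉ i∉R rewrite lookup∘tabulate (λ j → if does (j ∈? R) then f j else g j) i
                        | dec-false (i ∈? R) i∉R = refl

restrict : Subset m → Vec (Fin m) m → Vec (Fin m) m
restrict R σ = piecewise R (lookup σ) id

module _ {R : Subset m} (σ : Vec (Fin m) m) where

  restrict-∈ : ∀ {i} → i ∈ R → lookup (restrict R σ) i ≡ lookup σ i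
  restrict-∈ = piecewise-∈ (lookup σ) id

  restrict-∉ : ∀ {i} → i ∉ R → lookup (restrict R σ) i ≡ i
  restrict-∉ = piecewise-∉ (lookup σ) id

  Opener-restrict⇒∈ : ∀ {a} → Opener (restrict R σ) a → a ∈ R
  Opener-restrict⇒∈ {a} o with a ∈? R
  ... | yes a∈R = a∈R
  ... | no  a∉R = contradiction (subst (a <_) (restrict-∉ a∉R) o) (Fin.<-irrefl refl)

  Edge-restrict⁺ : ∀ {a b} → a ∈ R → b ∈ R → Edge σ a b → Edge (restrict R σ) a b
  Edge-restrict⁺ a∈R b∈R =
    Edge-cong {σ = σ} {τ = restrict R σ} (sym (restrict-∈ a∈R)) (sym (restrict-∈ b∈R))

  Edge-restrict⁻ : ∀ {a b} → Edge (restrict R σ) a b → Edge σ a b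
  Edge-restrict⁻ e@(oa , ob , _) =
    Edge-cong {σ = restrict R σ} {τ = σ}
      (restrict-∈ (Opener-restrict⇒∈ oa)) (restrict-∈ (Opener-restrict⇒∈ ob)) e

restrictMatching : {W : Subset m} (M : MatchingOn W) (R : Subset m) → R ⊆ W →
                   (∀ {i} → i ∈ R → lookup (MatchingOn.σ M) i ∈ R) → MatchingOn R
restrictMatching M R R⊆W closed = mkMatching (restrict R σ)
  (λ i i∈R → subst (_∈ R) (sym (restrict-∈ σ i∈R)) (closed i∈R))
  (λ i i∈R eq → σ-noFix M (R⊆W i∈R) (trans (sym (restrict-∈ σ i∈R)) eq))
  (λ i i∈R → begin
     lookup (restrict R σ) (lookup (restrict R σ) i) ≡⟨ cong (lookup (restrict R σ)) (restrict-∈ σ i∈R) ⟩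
     lookup (restrict R σ) (lookup σ i)              ≡⟨ restrict-∈ σ (closed i∈R) ⟩
     lookup σ (lookup σ i)                           ≡⟨ σ-involutive M (R⊆W i∈R) ⟩
     i                                               ∎)
  (λ i → restrict-∉ σ)
  where
  open ≡-Reasoning
  σ = MatchingOn.σ M

module _ {σ : Vec (Fin m) m} (R : Subset m) (o : Orientation σ) where

  restrictArc : Fin m → Fin m → Bool
  restrictArc a b = if does (a ∈? R) then (if does (b ∈? R) then arcOf o a b else false) else false

  restrictArc-∈ : ∀ {a b} → a ∈ R → b ∈ R → restrictArc a b ≡ arcOf o a b
  restrictArc-∈ {a} {b} a∈R b∈R rewrite dec-true (a ∈? R) a∈R | dec-true (b ∈? R) b∈R = refl

  restrictArc-∉ˡ : ∀ {a b} → a ∉ R → restrictArc a b ≡ false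
  restrictArc-∉ˡ {a} a∉R rewrite dec-false (a ∈? R) a∉R = refl

  restrictArc-∉ʳ : ∀ {a b} → b ∉ R → restrictArc a b ≡ false
  restrictArc-∉ʳ {a} {b} b∉R with does (a ∈? R)
  ... | true  rewrite dec-false (b ∈? R) b∉R = refl
  ... | false = refl

  restrictOrientation : Orientation (restrict R σ)
  restrictOrientation = orientation restrictArc onEdges oneWay
    where
    onEdges : ∀ {a b} → restrictArc a b ≡ true → Edge (restrict R σ) a b
    onEdges {a} {b} e with a ∈? R | b ∈? R
    ... | yes a∈R | yes b∈R = Edge-restrict⁺ σ a∈R b∈R (Arc⇒Edge o e)
    ... | no _    | _       = contradiction e λ ()
    ... | yes _   | no _    = contradiction e λ ()

    oneWay : ∀ {a b} → Edge (restrict R σ) a b → OneWay (restrictArc a b) (restrictArc b a)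
    oneWay e@(oa , ob , _) rewrite restrictArc-∈ (Opener-restrict⇒∈ σ oa) (Opener-restrict⇒∈ σ ob)
                                 | restrictArc-∈ (Opener-restrict⇒∈ σ ob) (Opener-restrict⇒∈ σ oa)
      = Edge⇒OneWay o (Edge-restrict⁻ σ e)

  arcOf-restrict : ∀ a b → arcOf restrictOrientation a b ≡ restrictArc a b
  arcOf-restrict = lookup²∘tabulate² restrictArc

module Glue {W R : Subset m} (R⊆W : R ⊆ W) (AR : Aug R) (AT : Aug (W ─ R)) where
  private
    MR = proj₁ AR
    MT = proj₁ AT
    σR = MatchingOn.σ MR
    σT = MatchingOn.σ MT
    oR = proj₂ AR
    oT = proj₂ AT

  σ : Vec (Fin m) m
  σ = piecewise R (lookup σR) (lookup σT)

  σ-∈ : ∀ {i} → i ∈ R → lookup σ i ≡ lookup σR i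
  σ-∈ = piecewise-∈ (lookup σR) (lookup σT)

  σ-∉ : ∀ {i} → i ∉ R → lookup σ i ≡ lookup σT i
  σ-∉ = piecewise-∉ (lookup σR) (lookup σT)

  σT-∉ : ∀ {i} → i ∈ W ─ R → lookup σT i ∉ R
  σT-∉ i∈T = x∈p─q⇒x∉q W R (σ-closed MT i∈T)

  matching : MatchingOn W
  matching = mkMatching σ closed noFix involutive outside
    where
    closed : ∀ i → i ∈ W → lookup σ i ∈ W
    closed i i∈W with i ∈? R
    ... | yes i∈R = subst (_∈ W) (sym (σ-∈ i∈R)) (R⊆W (σ-closed MR i∈R))
    ... | no  i∉R =
      subst (_∈ W) (sym (σ-∉ i∉R)) (p─q⊆p W R (σ-closed MT (x∈p∧x∉q⇒x∈p─q i∈W i∉R)))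

    noFix : ∀ i → i ∈ W → lookup σ i ≢ i
    noFix i i∈W with i ∈? R
    ... | yes i∈R = λ eq → σ-noFix MR i∈R (trans (sym (σ-∈ i∈R)) eq)
    ... | no  i∉R = λ eq → σ-noFix MT (x∈p∧x∉q⇒x∈p─q i∈W i∉R) (trans (sym (σ-∉ i∉R)) eq)

    involutive : ∀ i → i ∈ W → lookup σ (lookup σ i) ≡ i
    involutive i i∈W with i ∈? R
    ... | yes i∈R = begin
      lookup σ (lookup σ i)   ≡⟨ cong (lookup σ) (σ-∈ i∈R) ⟩
      lookup σ (lookup σR i)  ≡⟨ σ-∈ (σ-closed MR i∈R) ⟩
      lookup σR (lookup σR i) ≡⟨ σ-involutive MR i∈R ⟩
      i                       ∎
      where open ≡-Reasoning
    ... | no i∉R = begin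
      lookup σ (lookup σ i)   ≡⟨ cong (lookup σ) (σ-∉ i∉R) ⟩
      lookup σ (lookup σT i)  ≡⟨ σ-∉ (σT-∉ i∈T) ⟩
      lookup σT (lookup σT i) ≡⟨ σ-involutive MT i∈T ⟩
      i                       ∎
      where
      open ≡-Reasoning
      i∈T = x∈p∧x∉q⇒x∈p─q i∈W i∉R

    outside : ∀ i → i ∉ W → lookup σ i ≡ i
    outside i i∉W = trans (σ-∉ (i∉W ∘′ R⊆W)) (σ-outside MT (i∉W ∘′ p─q⊆p W R))

  Edge-R⁺ : ∀ {a b} → a ∈ R → b ∈ R → Edge σR a b → Edge σ a b
  Edge-R⁺ a∈R b∈R = Edge-cong {σ = σR} {τ = σ} (sym (σ-∈ a∈R)) (sym (σ-∈ b∈R))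

  Edge-R⁻ : ∀ {a b} → a ∈ R → b ∈ R → Edge σ a b → Edge σR a b
  Edge-R⁻ a∈R b∈R = Edge-cong {σ = σ} {τ = σR} (σ-∈ a∈R) (σ-∈ b∈R)

  Edge-T⁺ : ∀ {a b} → a ∉ R → b ∉ R → Edge σT a b → Edge σ a b
  Edge-T⁺ a∉R b∉R = Edge-cong {σ = σT} {τ = σ} (sym (σ-∉ a∉R)) (sym (σ-∉ b∉R))

  Edge-T⁻ : ∀ {a b} → a ∉ R → b ∉ R → Edge σ a b → Edge σT a b
  Edge-T⁻ a∉R b∉R = Edge-cong {σ = σ} {τ = σT} (σ-∉ a∉R) (σ-∉ b∉R)

  -- Crossing edges between the two parts are oriented into R.
  arc : Fin m → Fin m → Bool
  arc a b = if does (a ∈? R) then arcOf oR a b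
            else if does (b ∈? R) then does (Edge? σ a b) else arcOf oT a b

  private
    onEdges : ∀ {a b} → arc a b ≡ true → Edge σ a b
    onEdges {a} {b} e with a ∈? R | b ∈? R
    ... | yes a∈R | _ = let e′ = Arc⇒Edge oR e in Edge-R⁺ (Edge-∈ˡ MR e′) (Edge-∈ʳ MR e′) e′
    ... | no _    | yes _ = does⇒ (Edge? σ a b) e
    ... | no a∉R  | no b∉R = Edge-T⁺ a∉R b∉R (Arc⇒Edge oT e)

    oneWay : ∀ {a b} → Edge σ a b → OneWay (arc a b) (arc b a)
    oneWay {a} {b} e with a ∈? R | b ∈? R
    ... | yes a∈R | yes b∈R = Edge⇒OneWay oR (Edge-R⁻ a∈R b∈R e)
    ... | yes a∈R | no b∉R  =
      inj₂ (¬Edge⇒¬Arc oR (b∉R ∘′ Edge-∈ʳ MR) , dec-true (Edge? σ b a) (Edge-sym {σ = σ} e))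
    ... | no a∉R  | yes b∈R = inj₁ (dec-true (Edge? σ a b) e , ¬Edge⇒¬Arc oR (a∉R ∘′ Edge-∈ʳ MR))
    ... | no a∉R  | no b∉R  = Edge⇒OneWay oT (Edge-T⁻ a∉R b∉R e)

  glued : Aug W
  glued = matching , orientation arc onEdges oneWay

  arcOf-glued : ∀ a b → arcOf (proj₂ glued) a b ≡ arc a b
  arcOf-glued = lookup²∘tabulate² arc

  arc-∈ : ∀ {a b} → a ∈ R → arc a b ≡ arcOf oR a b
  arc-∈ {a} a∈R rewrite dec-true (a ∈? R) a∈R = refl

  arc-∉∉ : ∀ {a b} → a ∉ R → b ∉ R → arc a b ≡ arcOf oT a b
  arc-∉∉ {a} {b} a∉R b∉R rewrite dec-false (a ∈? R) a∉R | dec-false (b ∈? R) b∉R = refl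

  restrict-σ-R : ∀ i → lookup (restrict R σ) i ≡ lookup σR i
  restrict-σ-R i with i ∈? R
  ... | yes i∈R = trans (restrict-∈ σ i∈R) (σ-∈ i∈R)
  ... | no  i∉R = trans (restrict-∉ σ i∉R) (sym (σ-outside MR i∉R))

  restrict-σ-T : ∀ i → lookup (restrict (W ─ R) σ) i ≡ lookup σT i
  restrict-σ-T i with i ∈? W ─ R
  ... | yes i∈T = trans (restrict-∈ σ i∈T) (σ-∉ (x∈p─q⇒x∉q W R i∈T))
  ... | no  i∉T = trans (restrict-∉ σ i∉T) (sym (σ-outside MT i∉T))

  restrictArc-R : ∀ a b → restrictArc R (proj₂ glued) a b ≡ arcOf oR a b
  restrictArc-R a b with a ∈? R | b ∈? R
  ... | yes a∈R | yes _   = trans (arcOf-glued a b) (arc-∈ a∈R)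
  ... | no  a∉R | _       = sym (¬Edge⇒¬Arc oR (a∉R ∘′ Edge-∈ˡ MR))
  ... | yes _   | no  b∉R = sym (¬Edge⇒¬Arc oR (b∉R ∘′ Edge-∈ʳ MR))

  restrictArc-T : ∀ a b → restrictArc (W ─ R) (proj₂ glued) a b ≡ arcOf oT a b
  restrictArc-T a b with a ∈? W ─ R | b ∈? W ─ R
  ... | yes a∈T | yes b∈T =
    trans (arcOf-glued a b) (arc-∉∉ (x∈p─q⇒x∉q W R a∈T) (x∈p─q⇒x∉q W R b∈T))
  ... | no  a∉T | _       = sym (¬Edge⇒¬Arc oT (a∉T ∘′ Edge-∈ˡ MT))
  ... | yes _   | no  b∉T = sym (¬Edge⇒¬Arc oT (b∉T ∘′ Edge-∈ʳ MT))

rootConnected⇒connected : {σ : Vec (Fin m) m} (o : Orientation σ) (r : Fin m) →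
  (∀ {a} → Opener σ a → Star (Arc o) r a) →
  ∀ a b → Opener σ a → Opener σ b → Star (Edge σ) a b
rootConnected⇒connected {σ = σ} o r reach a b oa ob =
  Star.reverse (Edge-sym {σ = σ}) (Star.map (Arc⇒Edge o) (reach oa)) ◅◅ Star.map (Arc⇒Edge o) (reach ob)

IsMin-unique : {V : Subset m} {r r′ : Fin m} → IsMin V r → IsMin V r′ → r ≡ r′
IsMin-unique (r∈V , r≤) (r′∈V , r′≤) = Fin.≤-antisym (r≤ _ r′∈V) (r′≤ _ r∈V)

IsMin-⊆ : {V W : Subset m} {r : Fin m} → V ⊆ W → r ∈ V → IsMin W r → IsMin V r
IsMin-⊆ V⊆W r∈V (_ , r≤) = r∈V , λ j j∈V → r≤ j (V⊆W j∈V)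

module Reachability {σ : Vec (Fin m) m} (o : Orientation σ) (r : Fin m) where

  Reachable : Fin m → Set
  Reachable = Star (Arc o) r

  record ReachableSet : Set where
    field
      C      : Subset m
      root∈  : r ∈ C
      sound  : ∀ {x} → x ∈ C → Reachable x
      closed : ∀ {a b} → a ∈ C → Arc o a b → b ∈ C

    closed⋆ : ∀ {a b} → Star (Arc o) a b → a ∈ C → b ∈ C
    closed⋆ ε            a∈C = a∈C
    closed⋆ (e ◅ path) a∈C = closed⋆ path (closed a∈C e)

  private
    Grow? : (X : Subset m) → Decidable (λ b → b ∈ X ⊎ ∃ λ a → a ∈ X × Arc o a b)
    Grow? X b = b ∈? X ⊎-dec Fin.any? (λ a → (a ∈? X) ×-dec (arcOf o a b Bool.≟ true))

    grow : Subset m → Subset m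
    grow X = subset (Grow? X)

    X⊆grow : ∀ {X x} → x ∈ X → x ∈ grow X
    X⊆grow {X} x∈X = ∈subset⁺ (Grow? X) (inj₁ x∈X)

    Arc⇒∈grow : ∀ {X a b} → a ∈ X → Arc o a b → b ∈ grow X
    Arc⇒∈grow {X} a∈X e = ∈subset⁺ (Grow? X) (inj₂ (_ , a∈X , e))

    grow-sound : ∀ {X} → (∀ {x} → x ∈ X → Reachable x) → ∀ {x} → x ∈ grow X → Reachable x
    grow-sound {X} sound x∈grow with ∈subset⁻ (Grow? X) x∈grow
    ... | inj₁ x∈X           = sound x∈X
    ... | inj₂ (a , a∈X , e) = sound a∈X ◅◅ (e ◅ ε)

    -- Each non-final round adds an element, so m + 1 rounds suffice.
    saturate : (fuel : ℕ) (X : Subset m) → m ℕ.< ∣ X ∣ ℕ.+ fuel →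
               r ∈ X → (∀ {x} → x ∈ X → Reachable x) → ReachableSet
    saturate ℕ.zero X bound _ _ =
      contradiction (∣p∣≤n X) (ℕ.<⇒≱ (subst (m ℕ.<_) (ℕ.+-identityʳ _) bound))
    saturate (ℕ.suc fuel) X bound r∈X sound with Fin.any? (λ x → (x ∈? grow X) ×-dec ¬? (x ∈? X))
    ... | yes (x , x∈grow , x∉X) = saturate fuel (grow X) bound′ (X⊆grow r∈X) (grow-sound sound)
      where
      bound′ : m ℕ.< ∣ grow X ∣ ℕ.+ fuel
      bound′ = ℕ.<-≤-trans bound (subst (ℕ._≤ ∣ grow X ∣ ℕ.+ fuel) (sym (ℕ.+-suc ∣ X ∣ fuel))
                 (ℕ.+-monoˡ-≤ fuel (p⊂q⇒∣p∣<∣q∣ (X⊆grow , x , x∈grow , x∉X))))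
    ... | no nothing-new = record { C = X ; root∈ = r∈X ; sound = sound
                                  ; closed = λ a∈X e → stays (Arc⇒∈grow a∈X e) }
      where
      stays : ∀ {x} → x ∈ grow X → x ∈ X
      stays {x} x∈grow with x ∈? X
      ... | yes x∈X = x∈X
      ... | no  x∉X = contradiction (x , x∈grow , x∉X) nothing-new

  reachableSet : ReachableSet
  reachableSet = saturate (ℕ.suc m) ⁅ r ⁆ (ℕ.m≤n+m (ℕ.suc m) ∣ ⁅ r ⁆ ∣) (x∈⁅x⁆ r)
                   (λ x∈⁅r⁆ → subst Reachable (sym (x∈⁅y⁆⇒x≡y r x∈⁅r⁆)) ε)

record RootBlock (W : Subset m) (r : Fin m) : Set where
  constructor mkRootBlock
  field
    R    : Subset m
    .R⊆W : R ⊆ W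
    .r∈R : r ∈ R

SplitAug : Subset m → Fin m → Set
SplitAug W r = Σ (RootBlock W r) λ P → Irred (RootBlock.R P) × Aug (W ─ RootBlock.R P)

module Decompose {W : Subset m} {r : Fin m} (r-min : IsMin W r) (A : Aug W) where
  private
    M = proj₁ A
    o = proj₂ A
    σ = MatchingOn.σ M
  open Reachability o r
  open ReachableSet reachableSet public

  -- R is the union of the arches having an end in C, the vertices reachable from r.
  R? : Decidable (λ i → i ∈ W × (i ∈ C ⊎ lookup σ i ∈ C))
  R? i = (i ∈? W) ×-dec ((i ∈? C) ⊎-dec (lookup σ i ∈? C))

  R : Subset m
  R = subset R?

  R⊆W : R ⊆ W
  R⊆W i∈R = proj₁ (∈subset⁻ R? i∈R)

  r∈R : r ∈ R
  r∈R = ∈subset⁺ R? (proj₁ r-min , inj₁ root∈)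

  R-closed : ∀ {i} → i ∈ R → lookup σ i ∈ R
  R-closed {i} i∈R with ∈subset⁻ R? i∈R
  ... | i∈W , i∈C⊎σi∈C =
    ∈subset⁺ R? (σ-closed M i∈W , subst (λ j → lookup σ i ∈ C ⊎ j ∈ C) (sym (σ-involutive M i∈W))
                                     (swap i∈C⊎σi∈C))

  Opener-R⇒C : ∀ {a} → Opener σ a → a ∈ R → a ∈ C
  Opener-R⇒C {a} oa a∈R with ∈subset⁻ R? a∈R
  ... | _ , inj₁ a∈C = a∈C
  ... | a∈W , inj₂ σa∈C with Star⇒≡⊎Opener o (sound σa∈C)
  ...   | inj₁ r≡σa = contradiction (proj₂ r-min a a∈W) (ℕ.<⇒≱ (subst (a <_) (sym r≡σa) oa))
  ...   | inj₂ oσa  = contradiction oσa (partner-¬opener M oa)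

  C-Opener⇒R : ∀ {a} → a ∈ C → Opener σ a → a ∈ R
  C-Opener⇒R a∈C oa = ∈subset⁺ R? (opener-∈ M oa , inj₁ a∈C)

  Arc-R⇒R : ∀ {a b} → a ∈ R → Arc o a b → b ∈ R
  Arc-R⇒R a∈R e with Arc⇒Edge o e
  ... | oa , ob , _ = C-Opener⇒R (closed (Opener-R⇒C oa a∈R) e) ob

  private
    MR = restrictMatching M R R⊆W R-closed
    oR = restrictOrientation R o

  lift : ∀ {x y} → Star (Arc o) x y → x ∈ C → Star (Arc oR) x y
  lift ε _ = ε
  lift {x} (_◅_ {j = y} e path) x∈C with Arc⇒Edge o e
  ... | ox , oy , _ = e′ ◅ lift path y∈C
    where
    y∈C = closed x∈C e
    e′ : Arc oR x y
    e′ = trans (arcOf-restrict R o x y) (trans (restrictArc-∈ R o (C-Opener⇒R x∈C ox) (C-Opener⇒R y∈C oy)) e)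

  root-connected : ∀ {a} → Opener (restrict R σ) a → Star (Arc oR) r a
  root-connected {a} oa = lift (sound (Opener-R⇒C (subst (a <_) (restrict-∈ σ a∈R) oa) a∈R)) root∈
    where a∈R = Opener-restrict⇒∈ σ oa

  irred : Irred R
  irred = mkIrred MR oR (rootConnected⇒connected oR r root-connected)
    λ r′ r′-min a oa → subst (λ s → Star (Arc oR) s a)
                              (IsMin-unique (IsMin-⊆ R⊆W r∈R r-min) r′-min) (root-connected oa)

  T-closed : ∀ {i} → i ∈ W ─ R → lookup σ i ∈ W ─ R
  T-closed i∈T = x∈p∧x∉q⇒x∈p─q (σ-closed M i∈W)
    λ σi∈R → x∈p─q⇒x∉q W R i∈T (subst (_∈ R) (σ-involutive M i∈W) (R-closed σi∈R))
    where i∈W = p─q⊆p W R i∈T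

  decompose : SplitAug W r
  decompose = mkRootBlock R R⊆W r∈R , irred ,
              (restrictMatching M (W ─ R) (p─q⊆p W R) T-closed , restrictOrientation (W ─ R) o)

irredAug : {V : Subset m} → Irred V → Aug V
irredAug I = Irred.matching I , Irred.orient I

Irred-≡ : {V : Subset m} (I J : Irred V) → irredAug I ≡ irredAug J → I ≡ J
Irred-≡ (mkIrred M o _ _) (mkIrred .M .o _ _) refl = refl

module _ {W : Subset m} {r : Fin m} where

  RootBlock-⊆ : (P : RootBlock W r) → RootBlock.R P ⊆ W
  RootBlock-⊆ (mkRootBlock R R⊆W _) {i} i∈R = recompute (i ∈? W) (R⊆W i∈R)

  RootBlock-∋ : (P : RootBlock W r) → r ∈ RootBlock.R P
  RootBlock-∋ (mkRootBlock R _ r∈R) = recompute (r ∈? R) r∈R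

  glue : SplitAug W r → Aug W
  glue (P , I , AT) = Glue.glued (RootBlock-⊆ P) (irredAug I) AT

  SplitAug-≡ : (x y : SplitAug W r) → RootBlock.R (proj₁ x) ≡ RootBlock.R (proj₁ y) →
               irredAug (proj₁ (proj₂ x)) ≈ᴬ irredAug (proj₁ (proj₂ y)) →
               proj₂ (proj₂ x) ≈ᴬ proj₂ (proj₂ y) → x ≡ y
  SplitAug-≡ (mkRootBlock R _ _ , I , A) (mkRootBlock .R _ _ , J , B) refl I≈J A≈B
    rewrite Irred-≡ I J (≈ᴬ⇒≡ (irredAug I) (irredAug J) I≈J) | ≈ᴬ⇒≡ A B A≈B = refl

module _ {W : Subset m} {r : Fin m} (r-min : IsMin W r) (A : Aug W) where
  open Decompose r-min A
  private
    M = proj₁ A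
    o = proj₂ A
    σ = MatchingOn.σ M
    T = W ─ R
    module G = Glue (RootBlock-⊆ (proj₁ decompose)) (irredAug irred) (proj₂ (proj₂ decompose))

    ∉T : ∀ {i} → i ∉ R → i ∉ T → i ∉ W
    ∉T i∉R i∉T i∈W = i∉T (x∈p∧x∉q⇒x∈p─q i∈W i∉R)

    glued-σ : ∀ i → lookup G.σ i ≡ lookup σ i
    glued-σ i with i ∈? R | i ∈? W
    ... | yes i∈R | _       = trans (G.σ-∈ i∈R) (restrict-∈ σ i∈R)
    ... | no  i∉R | yes i∈W = trans (G.σ-∉ i∉R) (restrict-∈ σ (x∈p∧x∉q⇒x∈p─q i∈W i∉R))
    ... | no  i∉R | no  i∉W =
      trans (G.σ-∉ i∉R) (trans (restrict-∉ σ (i∉W ∘′ p─q⊆p W R)) (sym (σ-outside M i∉W)))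

    crossing-arc : ∀ {a b} → a ∉ R → b ∈ R → does (Edge? G.σ a b) ≡ arcOf o a b
    crossing-arc {a} {b} a∉R b∈R = does≡ (Edge? G.σ a b) edge ¬edge
      where
      edge : Edge G.σ a b → Arc o a b
      edge e with Edge⇒OneWay o (Edge-cong {σ = G.σ} {τ = σ} (glued-σ a) (glued-σ b) e)
      ... | inj₁ (a→b , _) = a→b
      ... | inj₂ (_ , b→a) = contradiction (Arc-R⇒R b∈R b→a) a∉R
      ¬edge : ¬ Edge G.σ a b → arcOf o a b ≡ false
      ¬edge ¬e = ¬Edge⇒¬Arc o (¬e ∘′ Edge-cong {σ = σ} {τ = G.σ} (sym (glued-σ a)) (sym (glued-σ b)))

    glued-arc : ∀ a b → G.arc a b ≡ arcOf o a b
    glued-arc a b with a ∈? R | b ∈? R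
    ... | yes a∈R | yes b∈R = trans (arcOf-restrict R o a b) (restrictArc-∈ R o a∈R b∈R)
    ... | yes a∈R | no  b∉R =
      trans (arcOf-restrict R o a b)
        (trans (restrictArc-∉ʳ R o {a = a} b∉R) (sym (Bool.¬-not (b∉R ∘′ Arc-R⇒R a∈R))))
    ... | no  a∉R | yes b∈R = crossing-arc a∉R b∈R
    glued-arc a b | no a∉R | no b∉R with a ∈? T | b ∈? T
    ... | yes a∈T | yes b∈T = trans (arcOf-restrict T o a b) (restrictArc-∈ T o a∈T b∈T)
    ... | no  a∉T | _ = trans (arcOf-restrict T o a b)
                          (trans (restrictArc-∉ˡ T o {b = b} a∉T)
                                 (sym (¬Edge⇒¬Arc o (∉T a∉R a∉T ∘′ Edge-∈ˡ M))))
    ... | _ | no  b∉T = trans (arcOf-restrict T o a b)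
                          (trans (restrictArc-∉ʳ T o {a = a} b∉T)
                                 (sym (¬Edge⇒¬Arc o (∉T b∉R b∉T ∘′ Edge-∈ʳ M))))

  glue∘decompose : glue decompose ≡ A
  glue∘decompose = ≈ᴬ⇒≡ (glue decompose) A (glued-σ , λ a b → trans (G.arcOf-glued a b) (glued-arc a b))

module DecomposeGlue {W R : Subset m} {r : Fin m} (r-min : IsMin W r) (R⊆W : R ⊆ W) (r∈R : r ∈ R)
  (AR : Aug R) .(reach : ∀ {a} → Opener (MatchingOn.σ (proj₁ AR)) a → Star (Arc (proj₂ AR)) r a)
  (AT : Aug (W ─ R)) where
  private
    MR = proj₁ AR
    σR = MatchingOn.σ MR
    oR = proj₂ AR
    module G = Glue R⊆W AR AT
    module D = Decompose r-min G.glued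
    oG = proj₂ G.glued

  Star-R⇒R : ∀ {a b} → Star (Arc oG) a b → a ∈ R → b ∈ R
  Star-R⇒R ε a∈R = a∈R
  Star-R⇒R {a} (_◅_ {j = b} e path) a∈R = Star-R⇒R path
    (Edge-∈ʳ MR (Arc⇒Edge oR (trans (sym (G.arc-∈ a∈R)) (trans (sym (G.arcOf-glued a b)) e))))

  lift : ∀ {a b} → Star (Arc oR) a b → Star (Arc oG) a b
  lift = Star.map λ {a} {b} e → trans (G.arcOf-glued a b) (trans (G.arc-∈ (Edge-∈ˡ MR (Arc⇒Edge oR e))) e)

  Opener⇒C : ∀ {a} → Opener σR a → a ∈ D.C
  Opener⇒C {a} oa = recompute (a ∈? D.C) (D.closed⋆ (lift (reach oa)) D.root∈)

  C⊆R : D.C ⊆ R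
  C⊆R x∈C = Star-R⇒R (D.sound x∈C) r∈R

  R⊆DR : R ⊆ D.R
  R⊆DR {i} i∈R with Fin.<-cmp i (lookup σR i)
  ... | tri< i<σi _ _ = ∈subset⁺ D.R? (R⊆W i∈R , inj₁ (Opener⇒C i<σi))
  ... | tri≈ _ i≡σi _ = contradiction (sym i≡σi) (σ-noFix MR i∈R)
  ... | tri> _ _ σi<i = ∈subset⁺ D.R? (R⊆W i∈R , inj₂ (subst (_∈ D.C) (sym (G.σ-∈ i∈R))
                          (Opener⇒C (subst (lookup σR i <_) (sym (σ-involutive MR i∈R)) σi<i))))

  DR⊆R : D.R ⊆ R
  DR⊆R {i} i∈DR with ∈subset⁻ D.R? i∈DR
  ... | _ , inj₁ i∈C = C⊆R i∈C
  ... | i∈W , inj₂ σi∈C with i ∈? R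
  ...   | yes i∈R = i∈R
  ...   | no  i∉R =
    contradiction (subst (_∈ R) (G.σ-∉ i∉R) (C⊆R σi∈C)) (G.σT-∉ (x∈p∧x∉q⇒x∈p─q i∈W i∉R))

  R-eq : D.R ≡ R
  R-eq = ⊆-antisym DR⊆R R⊆DR

  irred-≈ : irredAug D.irred ≈ᴬ AR
  irred-≈ = (λ i → subst (λ X → lookup (restrict X G.σ) i ≡ lookup σR i) (sym R-eq) (G.restrict-σ-R i))
          , (λ a b → subst (λ X → arcOf (restrictOrientation X oG) a b ≡ arcOf oR a b) (sym R-eq)
                       (trans (arcOf-restrict R oG a b) (G.restrictArc-R a b)))

  rest-≈ : proj₂ (proj₂ D.decompose) ≈ᴬ AT
  rest-≈ = (λ i → subst (λ X → lookup (restrict (W ─ X) G.σ) i ≡ lookup (MatchingOn.σ (proj₁ AT)) i)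
                         (sym R-eq) (G.restrict-σ-T i))
         , (λ a b → subst (λ X → arcOf (restrictOrientation (W ─ X) oG) a b ≡ arcOf (proj₂ AT) a b) (sym R-eq)
                      (trans (arcOf-restrict (W ─ R) oG a b) (G.restrictArc-T a b)))

decompose∘glue : {W : Subset m} {r : Fin m} (r-min : IsMin W r) (x : SplitAug W r) →
                 Decompose.decompose r-min (glue x) ≡ x
decompose∘glue r-min x@(P , I@(mkIrred _ _ _ rootConn) , AT) =
  SplitAug-≡ (Decompose.decompose r-min (glue x)) x DG.R-eq DG.irred-≈ DG.rest-≈
  where
  module DG = DecomposeGlue r-min (RootBlock-⊆ P) (RootBlock-∋ P) (irredAug I)
                (λ oa → rootConn _ (IsMin-⊆ (RootBlock-⊆ P) (RootBlock-∋ P) r-min) _ oa) AT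

Aug↔SplitAug : {W : Subset m} {r : Fin m} → IsMin W r → Aug W ↔ SplitAug W r
Aug↔SplitAug r-min = mk↔ₛ′ (Decompose.decompose r-min) glue (decompose∘glue r-min) (glue∘decompose r-min)

record BlocksOn (W : Subset m) : Set where
  constructor mkBlocks
  field
    blocks    : List (Subset m)
    .nonempty : All Nonempty blocks
    .disjoint : AllPairs (λ A B → Empty (A ∩ B)) blocks
    .covers   : ∀ i → i ∈ W → Any (i ∈_) blocks
    .inside   : All (_⊆ W) blocks
    .sorted   : AllPairs MinBefore blocks

PartOn : Subset m → Set
PartOn W = Σ (BlocksOn W) (λ π → All Irred (BlocksOn.blocks π))

SplitPart : Subset m → Fin m → Set
SplitPart W r = Σ (RootBlock W r) λ P → Irred (RootBlock.R P) × PartOn (W ─ RootBlock.R P)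

module _ {W : Subset m} {r : Fin m} (r-min : IsMin W r) where
  private
    Blocks = List (Subset m)

  first-block-∋-min : ∀ {B} {Bs : Blocks} → All (MinBefore B) Bs → B ⊆ W → Any (r ∈_) (B ∷ Bs) → r ∈ B
  first-block-∋-min _ _ (here r∈B) = r∈B
  first-block-∋-min (B<B′ ∷ _) B⊆W (there (here r∈B′)) with B<B′
  ... | j , j∈B , j<B′ = contradiction (proj₂ r-min j (B⊆W j∈B)) (ℕ.<⇒≱ (j<B′ r r∈B′))
  first-block-∋-min (_ ∷ B<Bs) B⊆W (there (there r∈Bs)) = first-block-∋-min B<Bs B⊆W (there r∈Bs)

  covers-rest : ∀ {B} {Bs : Blocks} → (∀ i → i ∈ W → Any (i ∈_) (B ∷ Bs)) →
                ∀ i → i ∈ W ─ B → Any (i ∈_) Bs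
  covers-rest {B} covers i i∈W─B with covers i (p─q⊆p W B i∈W─B)
  ... | here i∈B  = contradiction i∈B (x∈p─q⇒x∉q W B i∈W─B)
  ... | there any = any

  inside-rest : ∀ {B} {Bs : Blocks} → All (λ B′ → Empty (B ∩ B′)) Bs → All (_⊆ W) Bs →
                All (_⊆ W ─ B) Bs
  inside-rest []                  []              = []
  inside-rest (B∩B′=∅ ∷ disjoint) (B′⊆W ∷ inside) =
    (λ i∈B′ → x∈p∧x∉q⇒x∈p─q (B′⊆W i∈B′) λ i∈B → B∩B′=∅ (_ , x∈p∩q⁺ (i∈B , i∈B′)))
    ∷ inside-rest disjoint inside

  disjoint-head : ∀ {R} {Bs : Blocks} → All (_⊆ W ─ R) Bs → All (λ B → Empty (R ∩ B)) Bs
  disjoint-head = All.map λ B⊆W─R (_ , i∈R∩B) →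
    let i∈R , i∈B = x∈p∩q⁻ _ _ i∈R∩B in x∈p─q⇒x∉q W _ (B⊆W─R i∈B) i∈R

  sorted-head : ∀ {R} {Bs : Blocks} → r ∈ R → All (_⊆ W ─ R) Bs → All (MinBefore R) Bs
  sorted-head {R} r∈R = All.map λ B⊆W─R → r , r∈R , λ i i∈B →
    Fin.≤∧≢⇒< (proj₂ r-min i (p─q⊆p W R (B⊆W─R i∈B)))
              λ { refl → x∈p─q⇒x∉q W R (B⊆W─R i∈B) r∈R }

  inside-widen : ∀ {R} {Bs : Blocks} → All (_⊆ W ─ R) Bs → All (_⊆ W) Bs
  inside-widen []              = []
  inside-widen (B⊆W─R ∷ inside) = ⊆-trans B⊆W─R (p─q⊆p W _) ∷ inside-widen inside

  covers-cons : ∀ {R} {Bs : Blocks} → (∀ i → i ∈ W ─ R → Any (i ∈_) Bs) →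
                ∀ i → i ∈ W → Any (i ∈_) (R ∷ Bs)
  covers-cons {R} covers i i∈W with i ∈? R
  ... | yes i∈R = here i∈R
  ... | no  i∉R = there (covers i (x∈p∧x∉q⇒x∈p─q i∈W i∉R))

  splitFirst : PartOn W → SplitPart W r
  splitFirst (mkBlocks [] _ _ covers _ _ , []) = Irrelevant.⊥-elim (case-[] (covers r (proj₁ r-min)))
    where
    case-[] : ¬ Any (r ∈_) []
    case-[] ()
  splitFirst (mkBlocks (B ∷ Bs) nonempty disjoint covers inside sorted , I ∷ Is) =
    mkRootBlock B (All.head inside)
      (first-block-∋-min (AllPairs.head sorted) (All.head inside) (covers r (proj₁ r-min))) ,
    I , (mkBlocks Bs (All.tail nonempty) (AllPairs.tail disjoint) (covers-rest covers)
                  (inside-rest (AllPairs.head disjoint) (All.tail inside)) (AllPairs.tail sorted) , Is)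

  joinFirst : SplitPart W r → PartOn W
  joinFirst (mkRootBlock R R⊆W r∈R , I , (mkBlocks Bs nonempty disjoint covers inside sorted , Is)) =
    mkBlocks (R ∷ Bs) ((r , r∈R) ∷ nonempty) (disjoint-head inside ∷ disjoint) (covers-cons covers)
             (R⊆W ∷ inside-widen inside) (sorted-head r∈R inside ∷ sorted) ,
    I ∷ Is

  PartOn↔SplitPart : PartOn W ↔ SplitPart W r
  PartOn↔SplitPart = mk↔ₛ′ splitFirst joinFirst (λ _ → refl) joinFirst∘splitFirst
    where
    joinFirst∘splitFirst : ∀ π → joinFirst (splitFirst π) ≡ π
    joinFirst∘splitFirst (mkBlocks [] _ _ covers _ _ , []) = Irrelevant.⊥-elim (case-[] (covers r (proj₁ r-min)))
      where
      case-[] : ¬ Any (r ∈_) []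
      case-[] ()
    joinFirst∘splitFirst (mkBlocks (_ ∷ _) _ _ _ _ _ , _ ∷ _) = refl

module _ {W : Subset m} (W-empty : Empty W) where
  private
    ∉W : ∀ {i} → i ∉ W
    ∉W i∈W = W-empty (_ , i∈W)

    noMatching : MatchingOn W
    noMatching = mkMatching (tabulate id) (λ _ i∈W → ⊥-elim (∉W i∈W)) (λ _ i∈W → ⊥-elim (∉W i∈W))
                   (λ _ i∈W → ⊥-elim (∉W i∈W)) (λ i _ → lookup∘tabulate id i)

    noArcs : Aug W
    noArcs = noMatching , orientation (λ _ _ → false) (λ ()) (λ e → ⊥-elim (∉W (Edge-∈ˡ noMatching e)))

    noArcs-unique : ∀ A → noArcs ≡ A
    noArcs-unique (M , o) = ≈ᴬ⇒≡ noArcs (M , o)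
      ( (λ i → trans (lookup∘tabulate id i) (sym (σ-outside M ∉W)))
      , (λ a b → trans (lookup²∘tabulate² _ a b) (sym (¬Edge⇒¬Arc o (∉W ∘′ Edge-∈ˡ M)))))

    noBlocks : PartOn W
    noBlocks = mkBlocks [] [] [] (λ _ i∈W → ⊥-elim (∉W i∈W)) [] [] , []

    noBlocks-unique : ∀ π → noBlocks ≡ π
    noBlocks-unique (mkBlocks [] _ _ _ _ _ , []) = refl
    noBlocks-unique (mkBlocks (_ ∷ _) nonempty _ _ inside _ , _) =
      Irrelevant.⊥-elim (∉W (All.head inside (proj₂ (All.head nonempty))))

  Aug↔PartOn-empty : Aug W ↔ PartOn W
  Aug↔PartOn-empty = mk↔ₛ′ (λ _ → noBlocks) (λ _ → noArcs) noBlocks-unique noArcs-unique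

min-or-empty : (W : Subset m) → ∃ (IsMin W) ⊎ Empty W
min-or-empty Vec.[]     = inj₂ λ ()
min-or-empty (true ∷ W)  = inj₁ (Fin.zero , Vec.here , λ _ _ → ℕ.z≤n)
min-or-empty (false ∷ W) with min-or-empty W
... | inj₁ (i , i∈W , i≤) =
  inj₁ (Fin.suc i , Vec.there i∈W , λ { (Fin.suc j) (Vec.there j∈W) → ℕ.s≤s (i≤ j j∈W) })
... | inj₂ W-empty        = inj₂ λ { (Fin.suc i , Vec.there i∈W) → W-empty (i , i∈W) }

x∈p∩q⇒∣p─q∣<∣p∣ : {W R : Subset m} {r : Fin m} → r ∈ W → r ∈ R → ∣ W ─ R ∣ ℕ.< ∣ W ∣
x∈p∩q⇒∣p─q∣<∣p∣ {W = W} {R} r∈W r∈R = p∩q≢∅⇒∣p─q∣<∣p∣ W R (_ , x∈p∩q⁺ (r∈W , r∈R))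

-- k bounds ∣ W ∣, which makes the recursion on W ─ R structural.
Aug↔PartOn : (k : ℕ) (W : Subset m) → ∣ W ∣ ℕ.≤ k → Aug W ↔ PartOn W
Aug↔PartOn k W _ with min-or-empty W
... | inj₂ W-empty = Aug↔PartOn-empty W-empty
Aug↔PartOn ℕ.zero W ∣W∣≤0 | inj₁ (r , r∈W , _) =
  contradiction (ℕ.<-≤-trans (x∈p∩q⇒∣p─q∣<∣p∣ r∈W r∈W) ∣W∣≤0) ℕ.n≮0
Aug↔PartOn (ℕ.suc k) W ∣W∣≤1+k | inj₁ (r , r-min) =
  ↔-trans (Aug↔SplitAug r-min)
    (↔-trans (Σ-↔ ↔-refl λ {P} → ↔-refl ×-↔ rest {P}) (↔-sym (PartOn↔SplitPart r-min)))
  where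
  rest : ∀ {P : RootBlock W r} → Aug (W ─ RootBlock.R P) ↔ PartOn (W ─ RootBlock.R P)
  rest {P} = Aug↔PartOn k (W ─ RootBlock.R P)
    (ℕ.≤-pred (ℕ.<-≤-trans (x∈p∩q⇒∣p─q∣<∣p∣ (proj₁ r-min) (RootBlock-∋ P)) ∣W∣≤1+k))

AugMatching↔PartIrred : (m : ℕ) → AugMatching m ↔ PartIrred m
AugMatching↔PartIrred m = ↔-trans AugMatching↔Aug (↔-trans (Aug↔PartOn m ⊤ (∣p∣≤n ⊤)) PartOn↔PartIrred)
  where
  AugMatching↔Aug : AugMatching m ↔ Aug ⊤
  AugMatching↔Aug = mk↔ₛ′ (λ (mkAug M o) → M , o) (λ (M , o) → mkAug M o) (λ _ → refl) (λ _ → refl)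

  PartOn↔PartIrred : PartOn ⊤ ↔ PartIrred m
  PartOn↔PartIrred = mk↔ₛ′
    (λ (mkBlocks Bs nonempty disjoint covers _ sorted , Is) →
       mkPartition Bs nonempty disjoint (λ i → covers i ∈⊤) sorted , Is)
    (λ (mkPartition Bs nonempty disjoint covers sorted , Is) →
       mkBlocks Bs nonempty disjoint (λ i _ → covers i) (All.universal (λ _ {_} _ → ∈⊤) Bs) sorted , Is)
    (λ _ → refl) (λ _ → refl)

-- The bijection exists for every m.
proposition6p4 : (n : ℕ) → 1 ≤ n → AugMatching (2 * n) ⤖ PartIrred (2 * n)
proposition6p4 n _ = ↔⇒⤖ (AugMatching↔PartIrred (2 * n))
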